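{- Let $X=\{a,b\}$, let $u$ be a nonempty finite non-periodic word over $X$ and $W=u^\infty$. Let $v_0,\dots,v_n$ be all forks of $W$ ordered so that $z_0\le\dots\le z_n$ with $z_i=z(v_i)$, $v_0=W$, $v_n=\Lambda$. Let $v_i,v_{i'}$ be exceptional forks and $v_j=\Psi(v_i)$, $v_{j'}=\Psi(v_{i'})$. If $i\ne i'$, then $j\ne j'$.
   Context: A nonempty finite word is periodic if it equals $v^m$ for some word $v$ and $m\ge2$. $W=u^\infty$ is the two-sided infinite word with period $u=u_1\dots u_d$; $\Lambda$ is the empty word. A fork is a finite word $v$ such that $va,vb,av,bv$ are all subwords of $W$; by convention $W$ itself is also a fork. Significance: for a finite word $v$ of length $t$, $z(v)=|\{1\le i\le d:u_i\dots u_{i+t-1}=v\}|$ with cyclic indices; $z(W)=1$. An index $i\ge2$ (and $v_i$) is exceptional if $z_i>z_{i-1}+z_{i-2}$. For exceptional $v_i$, $\Psi(v_i)$ is the longest proper prefix of $v_{i-1}$ that is a fork. -}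

module Defs where

open import Data.Nat using (ℕ; zero; suc; _+_; _≤_; _<_; _∸_)
open import Data.Nat.DivMod using (_mod_)
open import Data.List using (List; []; _∷_; length; map; upTo; filter; lookup; _++_; _∷ʳ_; concat; replicate)
open import Data.List.Properties using (≡-dec)
open import Data.Product using (Σ; ∃; _×_; _,_)
open import Data.Unit using (⊤)
open import Relation.Nullary using (¬_; Dec; yes; no)
open import Relation.Binary.PropositionalEquality using (_≡_; _≢_; refl)

data Letter : Set where
  a b : Letter

_≟L_ : (x y : Letter) → Dec (x ≡ y)
a ≟L a = yes refl
a ≟L b = no (λ ())
b ≟L a = no (λ ())
b ≟L b = yes refl

Word : Set
Word = List Letter

_≟W_ : (x y : Word) → Dec (x ≡ y)
_≟W_ = ≡-dec _≟L_

Periodic : Word → Set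
Periodic u = Σ Word λ v → Σ ℕ λ m → 2 ≤ m × u ≡ concat (replicate m v)

-- cyclic letter u_k (indices taken modulo d = |u|; dummy value for u = [])
cyc : Word → ℕ → Letter
cyc [] k = a
cyc (x ∷ xs) k = lookup (x ∷ xs) (k mod (suc (length xs)))

window : Word → ℕ → ℕ → Word
window u i t = map (λ k → cyc u (i + k)) (upTo t)

-- w is a (finite) subword of W = u^∞
Subword : Word → Word → Set
Subword u w = Σ ℕ λ i → i < length u × window u i (length w) ≡ w

data Node : Set where
  W   : Node
  fin : Word → Node

IsFork : Word → Node → Set
IsFork u W = ⊤
IsFork u (fin v) =
  Subword u (v ∷ʳ a) × Subword u (v ∷ʳ b) × Subword u (a ∷ v) × Subword u (b ∷ v)

z : Word → Node → ℕ
z u W = 1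
z u (fin v) = length (filter (λ i → window u i (length v) ≟W v) (upTo (length u)))

ProperPrefix : Word → Word → Set
ProperPrefix p w = Σ Word λ s → s ≢ [] × p ++ s ≡ w

LongestForkPrefix : Word → Word → Node → Set
LongestForkPrefix u w x =
  Σ Word λ p → x ≡ fin p × ProperPrefix p w × IsFork u (fin p) ×
    ((q : Word) → ProperPrefix q w → IsFork u (fin q) → length q ≤ length p)

-- v = (v_0, ..., v_n) is an enumeration of all forks of W = u^∞, ordered by
-- nondecreasing significance, with v_0 = W and v_n = Λ
-- (v is a function ℕ → Node; only the values at indices ≤ n matter)
ForkEnumeration : Word → ℕ → (ℕ → Node) → Set
ForkEnumeration u n v =
  ((i : ℕ) → i ≤ n → IsFork u (v i)) ×
  ((x : Node) → IsFork u x → Σ ℕ λ i → i ≤ n × v i ≡ x) ×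
  ((i k : ℕ) → i ≤ n → k ≤ n → v i ≡ v k → i ≡ k) ×
  ((i : ℕ) → i < n → z u (v i) ≤ z u (v (suc i))) ×
  v 0 ≡ W ×
  v n ≡ fin []

Exceptional : Word → ℕ → (ℕ → Node) → ℕ → Set
Exceptional u n v i =
  2 ≤ i × i ≤ n × z u (v (i ∸ 1)) + z u (v (i ∸ 2)) < z u (v i)

IsPsi : Word → (ℕ → Node) → ℕ → Node → Set
IsPsi u v i x = Σ Word λ w → v (i ∸ 1) ≡ fin w × LongestForkPrefix u w x

-- Let p be the longest proper prefix of a fork w that is itself a fork, and write w = p c s.
-- Reading W from any occurrence of p c, the continuation must follow w all the way: the first
-- deviation would give a fork prefix of w longer than p. Hence, if two distinct forks w and w'
-- share p as Ψ, their letters after p differ (otherwise one would be a fork proper prefix of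
-- the other, longer than p), and every occurrence of p is followed by exactly one of w and w',
-- so z(p) = z(w) + z(w'). For exceptional i < i' with Ψ(v_i) = Ψ(v_{i'}) = v_j this gives
-- z_j = z_{i-1} + z_{i'-1}, which is too large if j < i' (as z_{i-1} ≥ 1) and too small if
-- j ≥ i' (as z_{i'} > z_{i'-1} + z_{i'-2} ≥ z_{i'-1} + z_{i-1}).
module Submission where

open import Defs
open import Data.Nat using (ℕ; zero; suc; _+_; _≤_; _<_; _∸_; z≤n; s≤s; z<s)
open import Data.Nat.Properties
open import Data.List using ([]; _∷_; [_]; length; upTo; applyUpTo; filter; _++_; _∷ʳ_)
open import Data.List.Properties using (∷-injective; ++-assoc; ++-identityʳ; length-++; map-upTo)
open import Data.List.Membership.Propositional.Properties using (∈-filter⁺; ∈-upTo⁺; ∈-length)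
open import Data.List.Relation.Unary.All as All using (All; []; _∷_)
open import Data.List.Relation.Unary.All.Properties using (all-upTo)
open import Data.Product using (Σ; _×_; _,_; proj₁; proj₂)
open import Data.Sum using (_⊎_; inj₁; inj₂; [_,_]′)
open import Data.Empty using (⊥; ⊥-elim)
open import Function using (_∘_)
open import Relation.Nullary using (¬_; yes; no; contradiction)
open import Level using (0ℓ)
open import Relation.Unary using (Pred; Decidable)
open import Relation.Binary.Definitions using (tri<; tri≈; tri>)
open import Relation.Binary.PropositionalEquality hiding ([_])

private
  variable
    w w' p r t : Word
    i m l n ℓ : ℕ
    x y c c' : Letter

≢-≢⇒≡ : x ≢ y → y ≢ c → x ≡ c
≢-≢⇒≡ {a} {a} {_} x≢y _   = ⊥-elim (x≢y refl)
≢-≢⇒≡ {b} {b} {_} x≢y _   = ⊥-elim (x≢y refl)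
≢-≢⇒≡ {_} {a} {a} _   y≢c = ⊥-elim (y≢c refl)
≢-≢⇒≡ {_} {b} {b} _   y≢c = ⊥-elim (y≢c refl)
≢-≢⇒≡ {a} {b} {a} _   _   = refl
≢-≢⇒≡ {b} {a} {b} _   _   = refl

length-<-++-∷ : ∀ (p : Word) c s → length p < length (p ++ c ∷ s)
length-<-++-∷ p c s = subst (length p <_) (sym (length-++ p)) (m<m+n (length p) z<s)

module _ {A : Set} {P Q R : Pred A 0ℓ} (P? : Decidable P) (Q? : Decidable Q) (R? : Decidable R) where

  length-filter-⊎ : ∀ zs → All (λ z → (P z → Q z ⊎ R z) × (Q z ⊎ R z → P z) × ¬ (Q z × R z)) zs →
    length (filter P? zs) ≡ length (filter Q? zs) + length (filter R? zs)
  length-filter-⊎ [] [] = refl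
  length-filter-⊎ (z ∷ zs) ((to , from , disjoint) ∷ hs) with P? z | Q? z | R? z
  ... | yes _ | yes q | yes r = ⊥-elim (disjoint (q , r))
  ... | yes _ | yes _ | no _  = cong suc (length-filter-⊎ zs hs)
  ... | yes _ | no _  | yes _ = trans (cong suc (length-filter-⊎ zs hs)) (sym (+-suc _ _))
  ... | yes pz | no ¬q | no ¬r = ⊥-elim ([ ¬q , ¬r ]′ (to pz))
  ... | no ¬p | yes q | _     = ⊥-elim (¬p (from (inj₁ q)))
  ... | no ¬p | no _  | yes r = ⊥-elim (¬p (from (inj₂ r)))
  ... | no _  | no _  | no _  = length-filter-⊎ zs hs

nondecreasing-≤ : (f : ℕ → ℕ) → (∀ k → k < n → f k ≤ f (suc k)) → m ≤ l → l ≤ n → f m ≤ f l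
nondecreasing-≤ {l = zero} f step z≤n _ = ≤-refl
nondecreasing-≤ {l = suc l} f step m≤l l<n with m≤n⇒m<n∨m≡n m≤l
... | inj₂ refl       = ≤-refl
... | inj₁ (s≤s m≤l') = ≤-trans (nondecreasing-≤ f step m≤l' (<⇒≤ l<n)) (step l l<n)

module _ (u : Word) where

  segment : ℕ → ℕ → Word
  segment i zero    = []
  segment i (suc m) = cyc u i ∷ segment (suc i) m

  applyUpTo-segment : ∀ i m (f : ℕ → Letter) → (∀ k → f k ≡ cyc u (i + k)) → applyUpTo f m ≡ segment i m
  applyUpTo-segment i zero    f f≗ = refl
  applyUpTo-segment i (suc m) f f≗ =
    cong₂ _∷_ (trans (f≗ 0) (cong (cyc u) (+-identityʳ i)))
              (applyUpTo-segment (suc i) m (f ∘ suc) (λ k → trans (f≗ (suc k)) (cong (cyc u) (+-suc i k))))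

  window≡segment : ∀ i m → window u i m ≡ segment i m
  window≡segment i m = trans (map-upTo _ m) (applyUpTo-segment i m _ (λ _ → refl))

  segment-++ : ∀ i m l → segment i (m + l) ≡ segment i m ++ segment (i + m) l
  segment-++ i zero    l = cong (λ k → segment k l) (sym (+-identityʳ i))
  segment-++ i (suc m) l =
    cong (cyc u i ∷_) (trans (segment-++ (suc i) m l) (cong (λ k → segment (suc i) m ++ segment k l) (sym (+-suc i m))))

  segment-++ˡ : ∀ i (r t : Word) → segment i (length (r ++ t)) ≡ r ++ t → segment i (length r) ≡ r
  segment-++ˡ i []      t eq = refl
  segment-++ˡ i (x ∷ r) t eq =
    cong₂ _∷_ (proj₁ (∷-injective eq)) (segment-++ˡ (suc i) r t (proj₂ (∷-injective eq)))

  segment-letter : ∀ i (r : Word) y t → segment i (length (r ++ y ∷ t)) ≡ r ++ y ∷ t → cyc u (i + length r) ≡ y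
  segment-letter i []      y t eq = trans (cong (cyc u) (+-identityʳ i)) (proj₁ (∷-injective eq))
  segment-letter i (x ∷ r) y t eq =
    trans (cong (cyc u) (+-suc i (length r))) (segment-letter (suc i) r y t (proj₂ (∷-injective eq)))

  segment-∷ʳ : ∀ i (r : Word) y → segment i (length r) ≡ r → cyc u (i + length r) ≡ y →
    segment i (length (r ∷ʳ y)) ≡ r ∷ʳ y
  segment-∷ʳ i []      y eq next = cong [_] (trans (cong (cyc u) (sym (+-identityʳ i))) next)
  segment-∷ʳ i (x ∷ r) y eq next =
    cong₂ _∷_ (proj₁ (∷-injective eq))
              (segment-∷ʳ (suc i) r y (proj₂ (∷-injective eq)) (trans (cong (cyc u) (sym (+-suc i (length r)))) next))

  OccursAt : ℕ → Word → Set
  OccursAt i w = window u i (length w) ≡ w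

  occurs? : ∀ w → Decidable (λ i → OccursAt i w)
  occurs? w i = window u i (length w) ≟W w

  occursAt⇒segment : ∀ i w → OccursAt i w → segment i (length w) ≡ w
  occursAt⇒segment i w = trans (sym (window≡segment i (length w)))

  segment⇒occursAt : ∀ i w → segment i (length w) ≡ w → OccursAt i w
  segment⇒occursAt i w = trans (window≡segment i (length w))

  occursAt-++ˡ : ∀ i r t → OccursAt i (r ++ t) → OccursAt i r
  occursAt-++ˡ i r t = segment⇒occursAt i r ∘ segment-++ˡ i r t ∘ occursAt⇒segment i (r ++ t)

  occursAt-letter : ∀ i r y t → OccursAt i (r ++ y ∷ t) → cyc u (i + length r) ≡ y
  occursAt-letter i r y t = segment-letter i r y t ∘ occursAt⇒segment i (r ++ y ∷ t)

  occursAt-∷ʳ : ∀ i r y → OccursAt i r → cyc u (i + length r) ≡ y → OccursAt i (r ∷ʳ y)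
  occursAt-∷ʳ i r y occ next = segment⇒occursAt i (r ∷ʳ y) (segment-∷ʳ i r y (occursAt⇒segment i r occ) next)

  occursAt-comparable : ∀ i w w' → OccursAt i w → OccursAt i w' → length w ≤ length w' →
    Σ Word λ t → w ++ t ≡ w'
  occursAt-comparable i w w' occ occ' |w|≤|w'| = segment (i + length w) (length w' ∸ length w) ,
    (begin
      w ++ segment (i + length w) (length w' ∸ length w)
        ≡⟨ cong (_++ segment (i + length w) (length w' ∸ length w)) (sym (occursAt⇒segment i w occ)) ⟩
      segment i (length w) ++ segment (i + length w) (length w' ∸ length w)
        ≡⟨ sym (segment-++ i (length w) (length w' ∸ length w)) ⟩
      segment i (length w + (length w' ∸ length w))
        ≡⟨ cong (segment i) (m+[n∸m]≡n |w|≤|w'|) ⟩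
      segment i (length w')
        ≡⟨ occursAt⇒segment i w' occ' ⟩
      w' ∎)
    where open ≡-Reasoning

  subword-++ˡ : ∀ r t → Subword u (r ++ t) → Subword u r
  subword-++ˡ r t (i , i<|u| , occ) = i , i<|u| , occursAt-++ˡ i r t occ

  fork⇒subwords : IsFork u (fin w) → Subword u w × Subword u (a ∷ w) × Subword u (b ∷ w)
  fork⇒subwords {w} (wa , _ , aw , bw) = subword-++ˡ w [ a ] wa , aw , bw

  fork-intro : x ≢ y → Subword u (r ∷ʳ x) → Subword u (r ∷ʳ y) → Subword u (a ∷ r) → Subword u (b ∷ r) →
    IsFork u (fin r)
  fork-intro {a} {a} a≢a _  _  _  _  = ⊥-elim (a≢a refl)
  fork-intro {a} {b} _   ra rb ar br = ra , rb , ar , br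
  fork-intro {b} {a} _   rb ra ar br = ra , rb , ar , br
  fork-intro {b} {b} b≢b _  _  _  _  = ⊥-elim (b≢b refl)

  ForkPrefixesAtMost : Word → ℕ → Set
  ForkPrefixesAtMost w ℓ = (q : Word) → ProperPrefix q w → IsFork u (fin q) → length q ≤ ℓ

  -- If W followed some occurrence of r only up to a letter different from w's, then r would be a
  -- fork: right special by this deviation, left special because a w and b w are subwords.
  occurrence-extends : IsFork u (fin w) → ForkPrefixesAtMost w ℓ → i < length u →
    ∀ r t → r ++ t ≡ w → ℓ < length r → OccursAt i r → OccursAt i w
  occurrence-extends {i = i} _ _ _ r [] r++[]≡w _ occ =
    subst (OccursAt i) (trans (sym (++-identityʳ r)) r++[]≡w) occ
  occurrence-extends {i = i} fork longest i<|u| r (y ∷ t) r++yt≡w ℓ<|r| occ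
    with cyc u (i + length r) ≟L y
  ... | yes next≡y =
    occurrence-extends fork longest i<|u| (r ∷ʳ y) t (trans (++-assoc r [ y ] t) r++yt≡w)
      (<-≤-trans ℓ<|r| (<⇒≤ (length-<-++-∷ r y []))) (occursAt-∷ʳ i r y occ next≡y)
  ... | no next≢y = contradiction (longest r (y ∷ t , (λ ()) , r++yt≡w) r-fork) (<⇒≱ ℓ<|r|)
    where
    w-subwords = fork⇒subwords fork
    r-fork : IsFork u (fin r)
    r-fork = fork-intro (next≢y ∘ sym)
      (subword-++ˡ (r ∷ʳ y) t (subst (Subword u) (sym (trans (++-assoc r [ y ] t) r++yt≡w)) (proj₁ w-subwords)))
      (i , i<|u| , occursAt-∷ʳ i r _ occ refl)
      (subword-++ˡ (a ∷ r) (y ∷ t) (subst (λ q → Subword u (a ∷ q)) (sym r++yt≡w) (proj₁ (proj₂ w-subwords))))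
      (subword-++ˡ (b ∷ r) (y ∷ t) (subst (λ q → Subword u (b ∷ q)) (sym r++yt≡w) (proj₂ (proj₂ w-subwords))))

  occurrence-extends-∷ʳ : ∀ {s} → IsFork u (fin (p ++ c ∷ s)) → ForkPrefixesAtMost (p ++ c ∷ s) (length p) →
    i < length u → OccursAt i (p ∷ʳ c) → OccursAt i (p ++ c ∷ s)
  occurrence-extends-∷ʳ {p} {c} {s = s} fork longest i<|u| =
    occurrence-extends fork longest i<|u| (p ∷ʳ c) s (++-assoc p [ c ] s) (length-<-++-∷ p c [])

  fork-prefix-equal : IsFork u (fin w) → ForkPrefixesAtMost w' ℓ → ℓ < length w → w ++ t ≡ w' → w ≡ w'
  fork-prefix-equal {w} {t = []}    _    _       _        w++[]≡w' = trans (sym (++-identityʳ w)) w++[]≡w'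
  fork-prefix-equal {w} {t = y ∷ t} fork longest ℓ<|w| w++yt≡w' =
    contradiction (longest w (y ∷ t , (λ ()) , w++yt≡w') fork) (<⇒≱ ℓ<|w|)

  co-occurring-forks-equal : IsFork u (fin w) → IsFork u (fin w') →
    ForkPrefixesAtMost w ℓ → ForkPrefixesAtMost w' ℓ → ℓ < length w → ℓ < length w' →
    OccursAt i w → OccursAt i w' → w ≡ w'
  co-occurring-forks-equal {w} {w'} {i = i} fork fork' longest longest' ℓ<|w| ℓ<|w'| occ occ'
    with ≤-total (length w) (length w')
  ... | inj₁ |w|≤|w'| =
    fork-prefix-equal fork longest' ℓ<|w| (proj₂ (occursAt-comparable i w w' occ occ' |w|≤|w'|))
  ... | inj₂ |w'|≤|w| =
    sym (fork-prefix-equal fork' longest ℓ<|w'| (proj₂ (occursAt-comparable i w' w occ' occ |w'|≤|w|)))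

  same-next-letter⇒equal : ∀ {s s'} → IsFork u (fin (p ++ c ∷ s)) → IsFork u (fin (p ++ c ∷ s')) →
    ForkPrefixesAtMost (p ++ c ∷ s) (length p) → ForkPrefixesAtMost (p ++ c ∷ s') (length p) →
    p ++ c ∷ s ≡ p ++ c ∷ s'
  same-next-letter⇒equal {p} {c} {s} {s'} fork fork' longest longest' with proj₁ (fork⇒subwords fork)
  ... | k , k<|u| , occ =
    co-occurring-forks-equal fork fork' longest longest' (length-<-++-∷ p c s) (length-<-++-∷ p c s') occ
      (occurrence-extends-∷ʳ fork' longest' k<|u|
        (occursAt-++ˡ k (p ∷ʳ c) s (subst (OccursAt k) (sym (++-assoc p [ c ] s)) occ)))

  subword⇒0<significance : Subword u w → 0 < z u (fin w)
  subword⇒0<significance {w} (i , i<|u| , occ) = ∈-length (∈-filter⁺ (occurs? w) (∈-upTo⁺ i<|u|) occ)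

  fork⇒0<significance : ∀ {x} → IsFork u x → 0 < z u x
  fork⇒0<significance {W}     _    = z<s
  fork⇒0<significance {fin w} fork = subword⇒0<significance (proj₁ (fork⇒subwords fork))

  significance-split : ∀ {s s'} → c ≢ c' → IsFork u (fin (p ++ c ∷ s)) → IsFork u (fin (p ++ c' ∷ s')) →
    ForkPrefixesAtMost (p ++ c ∷ s) (length p) → ForkPrefixesAtMost (p ++ c' ∷ s') (length p) →
    z u (fin p) ≡ z u (fin (p ++ c ∷ s)) + z u (fin (p ++ c' ∷ s'))
  significance-split {c} {c'} {p} {s} {s'} c≢c' fork fork' longest longest' =
    length-filter-⊎ (occurs? p) (occurs? (p ++ c ∷ s)) (occurs? (p ++ c' ∷ s')) (upTo (length u))
      (All.map (λ {i} i<|u| → continues i i<|u| , restricts i , exclusive i) (all-upTo (length u)))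
    where
    continues : ∀ i → i < length u → OccursAt i p → OccursAt i (p ++ c ∷ s) ⊎ OccursAt i (p ++ c' ∷ s')
    continues i i<|u| occ with cyc u (i + length p) ≟L c
    ... | yes next≡c = inj₁ (occurrence-extends-∷ʳ fork longest i<|u| (occursAt-∷ʳ i p c occ next≡c))
    ... | no next≢c  =
      inj₂ (occurrence-extends-∷ʳ fork' longest' i<|u| (occursAt-∷ʳ i p c' occ (≢-≢⇒≡ next≢c c≢c')))
    restricts : ∀ i → OccursAt i (p ++ c ∷ s) ⊎ OccursAt i (p ++ c' ∷ s') → OccursAt i p
    restricts i = [ occursAt-++ˡ i p (c ∷ s) , occursAt-++ˡ i p (c' ∷ s') ]′
    exclusive : ∀ i → ¬ (OccursAt i (p ++ c ∷ s) × OccursAt i (p ++ c' ∷ s'))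
    exclusive i (occ , occ') = c≢c' (trans (sym (occursAt-letter i p c s occ)) (occursAt-letter i p c' s' occ'))

  shared-longest-fork-prefix : ∀ {x} → IsFork u (fin w) → IsFork u (fin w') → w ≢ w' →
    LongestForkPrefix u w x → LongestForkPrefix u w' x → z u x ≡ z u (fin w) + z u (fin w')
  shared-longest-fork-prefix _ _ _ (_ , _ , ([] , s≢[] , _) , _) _ = ⊥-elim (s≢[] refl)
  shared-longest-fork-prefix _ _ _ _ (_ , _ , ([] , s≢[] , _) , _) = ⊥-elim (s≢[] refl)
  shared-longest-fork-prefix fork fork' w≢w'
    (p , refl , (c ∷ s , _ , refl) , _ , longest) (_ , refl , (c' ∷ s' , _ , refl) , _ , longest') with c ≟L c'
  ... | yes refl = contradiction (same-next-letter⇒equal fork fork' longest longest') w≢w'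
  ... | no c≢c'  = significance-split c≢c' fork fork' longest longest'

-- With i = k + 2 and i' = k' + 2 the truncated subtractions in Exceptional and IsPsi compute.
exceptional-Ψ-distinct : ∀ {u n v i i' j} → ForkEnumeration u n v → Exceptional u n v i → Exceptional u n v i' →
  i < i' → j ≤ n → IsPsi u v i (v j) → IsPsi u v i' (v j) → ⊥
exceptional-Ψ-distinct {u} {n} {v} {j = j} (forks , _ , injective , step , _ , _)
  (s≤s (s≤s {n = k} _) , i≤n , _) (s≤s (s≤s {n = k'} _) , i'≤n , exceptional')
  (s≤s (s≤s k<k')) j≤n (w , vᵢ₋₁≡w , ψ) (w' , vᵢ'₋₁≡w' , ψ') =
  [ too-small , too-large ]′ (≤-<-connex (suc (suc k')) j)
  where
  Z : ℕ → ℕ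
  Z m = z u (v m)
  k'≤n : k' ≤ n
  k'≤n = ≤-trans (n≤1+n k') (<⇒≤ i'≤n)
  mono : ∀ {m l} → m ≤ l → l ≤ n → Z m ≤ Z l
  mono = nondecreasing-≤ Z step
  w≢w' : w ≢ w'
  w≢w' w≡w' = <⇒≢ (s≤s k<k')
    (injective (suc k) (suc k') (<⇒≤ i≤n) (<⇒≤ i'≤n) (trans vᵢ₋₁≡w (trans (cong fin w≡w') (sym vᵢ'₋₁≡w'))))
  w-fork : IsFork u (fin w)
  w-fork = subst (IsFork u) vᵢ₋₁≡w (forks (suc k) (<⇒≤ i≤n))
  w'-fork : IsFork u (fin w')
  w'-fork = subst (IsFork u) vᵢ'₋₁≡w' (forks (suc k') (<⇒≤ i'≤n))
  split : Z j ≡ Z (suc k) + Z (suc k')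
  split = trans (shared-longest-fork-prefix u w-fork w'-fork w≢w' ψ ψ')
                (sym (cong₂ _+_ (cong (z u) vᵢ₋₁≡w) (cong (z u) vᵢ'₋₁≡w')))
  open ≤-Reasoning
  too-small : suc (suc k') ≤ j → ⊥
  too-small i'≤j = <-irrefl refl (begin-strict
    Z (suc k') + Z k'      <⟨ exceptional' ⟩
    Z (suc (suc k'))       ≤⟨ mono i'≤j j≤n ⟩
    Z j                    ≡⟨ split ⟩
    Z (suc k) + Z (suc k') ≤⟨ +-monoˡ-≤ (Z (suc k')) (mono k<k' k'≤n) ⟩
    Z k' + Z (suc k')      ≡⟨ +-comm (Z k') (Z (suc k')) ⟩
    Z (suc k') + Z k'      ∎)
  too-large : j < suc (suc k') → ⊥
  too-large (s≤s j≤i'-1) = <-irrefl refl (begin-strict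
    Z (suc k')             <⟨ +-monoˡ-≤ (Z (suc k')) (fork⇒0<significance u (forks (suc k) (<⇒≤ i≤n))) ⟩
    Z (suc k) + Z (suc k') ≡⟨ split ⟨
    Z j                    ≤⟨ mono j≤i'-1 (<⇒≤ i'≤n) ⟩
    Z (suc k')             ∎)

proposition3p14 : (u : Word) → u ≢ [] → ¬ Periodic u →
    (n : ℕ) (v : ℕ → Node) → ForkEnumeration u n v →
    (i i' j j' : ℕ) → Exceptional u n v i → Exceptional u n v i' →
    j ≤ n → j' ≤ n → IsPsi u v i (v j) → IsPsi u v i' (v j') →
    i ≢ i' → j ≢ j'
proposition3p14 u _ _ n v enum i i' j _ exᵢ exᵢ' j≤n _ ψᵢ ψᵢ' i≢i' refl with <-cmp i i'
... | tri< i<i' _ _ = exceptional-Ψ-distinct enum exᵢ exᵢ' i<i' j≤n ψᵢ ψᵢ'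
... | tri≈ _ i≡i' _ = i≢i' i≡i'
... | tri> _ _ i'<i = exceptional-Ψ-distinct enum exᵢ' exᵢ i'<i j≤n ψᵢ' ψᵢ
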